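{- Let $m\ge1$ and let $\delta_m=m(m-1)\cdots 21$ be the decreasing permutation of $[m]$, viewed as a word. Then $\delta_m$ is strongly stable: $C(\delta_m^k)=C(\delta_m)$ for every integer $k\ge1$.
   Context: Words are finite sequences of positive integers; juxtaposition denotes concatenation, and $u^k$ denotes $u$ concatenated with itself $k$ times. For a word $w$, $P(w)$ is its insertion tableau under the Robinson–Schensted–Knuth (row-insertion) correspondence. The centralizer of a word $u$ is $C(u)=\{w \text{ a word over the positive integers} : P(uw)=P(wu)\}$. -}

module Defs where

open import Data.Nat using (ℕ; zero; suc; _≤_; _<?_)
open import Data.List using (List; []; _∷_; _++_; foldl)
open import Data.List.Relation.Unary.All using (All)
open import Data.Product using (_×_; _,_)
open import Relation.Nullary using (yes; no)
open import Relation.Binary.PropositionalEquality using (_≡_)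

-- A word is a finite list of letters; letters of words in the paper are
-- positive integers (enforced by `IsWord` where needed).
Word : Set
Word = List ℕ

IsWord : Word → Set
IsWord w = All (1 ≤_) w

-- A (semistandard) tableau in English notation: list of rows, top row first,
-- each row weakly increasing left to right.
Tableau : Set
Tableau = List (List ℕ)

data Bump : Set where
  none : Bump
  out  : ℕ → Bump

rowInsert : ℕ → List ℕ → List ℕ × Bump
rowInsert x [] = (x ∷ [] , none)
rowInsert x (y ∷ ys) with x <? y
... | yes _ = (x ∷ ys , out y)
... | no  _ with rowInsert x ys
...   | (ys' , b) = (y ∷ ys' , b)

insert : ℕ → Tableau → Tableau
insert x [] = (x ∷ []) ∷ []
insert x (r ∷ rs) with rowInsert x r
... | (r' , none)  = r' ∷ rs
... | (r' , out y) = r' ∷ insert y rs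

P : Word → Tableau
P w = foldl (λ T x → insert x T) [] w

_∈C_ : Word → Word → Set
w ∈C u = IsWord w × (P (u ++ w) ≡ P (w ++ u))

_^ʷ_ : Word → ℕ → Word
u ^ʷ zero = []
u ^ʷ suc k = u ++ (u ^ʷ k)

δ : ℕ → Word
δ zero = []
δ (suc m) = suc m ∷ δ m

{-# OPTIONS --safe #-}

-- Write T ⟵ v for inserting the letters of v into T one after another, so that
-- P (u ++ v) = P u ⟵ v. Inserting letters ≥ i commutes with prepending the column
-- i, i+1, …, i+n−1 to the first n rows, and P (δ m ^ʷ k) consists of k columns 1, …, m;
-- hence P (δ m ^ʷ k ++ w) is P w with k columns 1, …, m prepended. On the other side
-- P (w ++ δ m ^ʷ k) = P w ⟵ δ m ^ʷ k. If the first m rows of P w have all entries ≤ m,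
-- each copy of δ m pushes one more column 1, …, m in from the left and the two sides agree.
-- Otherwise take the first of these rows with an entry > m. Only letters ≤ m reach it, and
-- each of them either replaces an entry in place or evicts an entry > m, so entries never get
-- prepended to it. The condition on P w does not involve k, so it describes both C (δ m ^ʷ k)
-- and C (δ m).

module Submission where

open import Defs
open import Data.Bool using (true; false)
open import Data.Empty using (⊥-elim)
open import Data.List using (List; []; _∷_; _++_; foldl; length; replicate; take; filter)
open import Data.List.Properties
  using (foldl-++; ++-identityʳ; length-++; length-++-≤ʳ; filter-++; filter-accept; filter-reject; ∷-injective)
open import Data.List.Relation.Unary.All using (All; []; _∷_; all?)
import Data.List.Relation.Unary.All as All
open import Data.List.Relation.Unary.All.Properties using (++⁺; ¬All⇒Any¬)
open import Data.List.Relation.Unary.AllPairs using (AllPairs; []; _∷_)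
open import Data.List.Relation.Unary.Any using (Any; here; there)
import Data.List.Relation.Unary.Any as Any
open import Data.Nat using (ℕ; zero; suc; _+_; _≤_; _<_; z≤n; s≤s; _<?_; _≤?_; _≤ᵇ_; _<ᵇ_)
open import Data.Nat.Properties
open import Data.List.Sort.InsertionSort.Base ≤-decTotalOrder
  using () renaming (insert to sortedInsert)
open import Data.Product using (_×_; _,_; proj₁; proj₂)
open import Data.Sum using (_⊎_; inj₁; inj₂)
open import Data.Unit using (⊤; tt)
open import Function.Bundles using (_⇔_; mk⇔)
open import Function.Construct.Composition using (_⇔-∘_)
open import Function.Construct.Symmetry using (⇔-sym)
open import Relation.Binary.PropositionalEquality
open import Relation.Nullary using (yes; no; ¬_)
open import Relation.Nullary.Reflects using (ofʸ; ofⁿ)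

Sorted : List ℕ → Set
Sorted = AllPairs _≤_

_⟵_ : Tableau → Word → Tableau
T ⟵ v = foldl (λ T x → insert x T) T v

bumped : Bump → Word
bumped none    = []
bumped (out y) = y ∷ []

rowInsertWord : List ℕ → Word → List ℕ × Word
rowInsertWord r []      = r , []
rowInsertWord r (x ∷ v) =
  let (r′ , b) = rowInsert x r ; (r″ , bs) = rowInsertWord r′ v in r″ , bumped b ++ bs

rowInsert-< : ∀ {x y} ys → x < y → rowInsert x (y ∷ ys) ≡ (x ∷ ys , out y)
rowInsert-< {x} {y} ys x<y with x <? y
... | yes _   = refl
... | no x≮y = ⊥-elim (x≮y x<y)

rowInsert-≮ : ∀ {x y} ys → ¬ x < y →
              rowInsert x (y ∷ ys) ≡ (y ∷ proj₁ (rowInsert x ys) , proj₂ (rowInsert x ys))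
rowInsert-≮ {x} {y} ys x≮y with x <? y
... | yes x<y = ⊥-elim (x≮y x<y)
... | no _    = refl

rowInsert-All : ∀ {Q : ℕ → Set} x r → All Q (x ∷ r) →
                All Q (proj₁ (rowInsert x r)) × All Q (bumped (proj₂ (rowInsert x r)))
rowInsert-All x []       (qx ∷ [])       = qx ∷ [] , []
rowInsert-All x (y ∷ ys) (qx ∷ qy ∷ qys) with x <? y
... | yes _ = qx ∷ qys , qy ∷ []
... | no _  = let (qr , qb) = rowInsert-All x ys (qx ∷ qys) in qy ∷ qr , qb

rowInsert-bumped> : ∀ x r → All (x <_) (bumped (proj₂ (rowInsert x r)))
rowInsert-bumped> x []       = []
rowInsert-bumped> x (y ∷ ys) with x <? y
... | yes x<y = x<y ∷ []
... | no _    = rowInsert-bumped> x ys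

rowInsert-sorted : ∀ x r → Sorted r → Sorted (proj₁ (rowInsert x r))
rowInsert-sorted x []       []           = [] ∷ []
rowInsert-sorted x (y ∷ ys) (y≤ys ∷ sys) with x <? y
... | yes x<y = All.map (≤-trans (<⇒≤ x<y)) y≤ys ∷ sys
... | no x≮y  = proj₁ (rowInsert-All x ys (≮⇒≥ x≮y ∷ y≤ys)) ∷ rowInsert-sorted x ys sys

rowInsertWord-All : ∀ {Q : ℕ → Set} r v → All Q r → All Q v →
                    All Q (proj₁ (rowInsertWord r v)) × All Q (proj₂ (rowInsertWord r v))
rowInsertWord-All r []      qr _         = qr , []
rowInsertWord-All r (x ∷ v) qr (qx ∷ qv) =
  let (qr′ , qb)  = rowInsert-All x r (qx ∷ qr)
      (qr″ , qbs) = rowInsertWord-All (proj₁ (rowInsert x r)) v qr′ qv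
  in qr″ , ++⁺ qb qbs

⟵-++ : ∀ T u v → T ⟵ (u ++ v) ≡ (T ⟵ u) ⟵ v
⟵-++ T u v = foldl-++ _ T u v

⟵-∷ : ∀ r rs v → (r ∷ rs) ⟵ v ≡ proj₁ (rowInsertWord r v) ∷ rs ⟵ proj₂ (rowInsertWord r v)
⟵-∷ r rs []      = refl
⟵-∷ r rs (x ∷ v) with rowInsert x r
... | r′ , none  = ⟵-∷ r′ rs v
... | r′ , out y = ⟵-∷ r′ (insert y rs) v

⟵-preserves : ∀ {Q : ℕ → Set} (Inv : Tableau → Set) →
              (∀ {x} T → Q x → Inv T → Inv (insert x T)) →
              ∀ {T} v → All Q v → Inv T → Inv (T ⟵ v)
⟵-preserves Inv step     []      []        inv = inv
⟵-preserves Inv step {T} (x ∷ v) (qx ∷ qv) inv = ⟵-preserves Inv step v qv (step T qx inv)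

-- What the argument needs of a semistandard tableau; columns are not required to increase.
Staircase : ℕ → Tableau → Set
Staircase i []       = ⊤
Staircase i (r ∷ rs) = Sorted r × All (i ≤_) r × Staircase (suc i) rs

insert-staircase : ∀ {i y} T → i ≤ y → Staircase i T → Staircase i (insert y T)
insert-staircase         []       i≤y _               = [] ∷ [] , i≤y ∷ [] , tt
insert-staircase {y = y} (r ∷ rs) i≤y (sr , i≤r , st)
  with rowInsert y r | rowInsert-sorted y r sr | rowInsert-All y r (i≤y ∷ i≤r) | rowInsert-bumped> y r
... | r′ , none  | sr′ | i≤r′ , _ | _        = sr′ , i≤r′ , st
... | r′ , out z | sr′ | i≤r′ , _ | y<z ∷ [] =
  sr′ , i≤r′ , insert-staircase rs (≤-trans (s≤s i≤y) y<z) st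

P-staircase : ∀ w → IsWord w → Staircase 1 (P w)
P-staircase w pw = ⟵-preserves (Staircase 1) insert-staircase w pw tt

TopRowsAtMost : ℕ → ℕ → Tableau → Set
TopRowsAtMost n m T = All (All (_≤ m)) (take n T)

topRowsAtMost-[] : ∀ n m → TopRowsAtMost n m []
topRowsAtMost-[] zero    m = []
topRowsAtMost-[] (suc n) m = []

insert-topRowsAtMost : ∀ {n m x} T → x ≤ m → TopRowsAtMost n m T → TopRowsAtMost n m (insert x T)
insert-topRowsAtMost {zero}          T        x≤m _            = []
insert-topRowsAtMost {suc n} {m}     []       x≤m _            = (x≤m ∷ []) ∷ topRowsAtMost-[] n m
insert-topRowsAtMost {suc n} {m} {x} (r ∷ rs) x≤m (r≤m ∷ rs≤m)
  with rowInsert x r | rowInsert-All x r (x≤m ∷ r≤m)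
... | r′ , none  | r′≤m , _        = r′≤m ∷ rs≤m
... | r′ , out z | r′≤m , z≤m ∷ [] = r′≤m ∷ insert-topRowsAtMost rs z≤m rs≤m

prependColumns : ℕ → ℕ → ℕ → Tableau → Tableau
prependColumns k i zero    T        = T
prependColumns k i (suc n) []       = replicate k i ∷ prependColumns k (suc i) n []
prependColumns k i (suc n) (r ∷ rs) = (replicate k i ++ r) ∷ prependColumns k (suc i) n rs

replicate-++-∷ : ∀ {x : ℕ} k xs → replicate k x ++ x ∷ xs ≡ x ∷ replicate k x ++ xs
replicate-++-∷ zero    xs = refl
replicate-++-∷ (suc k) xs = cong (_ ∷_) (replicate-++-∷ k xs)

prependColumns-suc : ∀ k i n T →
  prependColumns k i n (prependColumns 1 i n T) ≡ prependColumns (suc k) i n T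
prependColumns-suc k i zero    T        = refl
prependColumns-suc k i (suc n) []       =
  cong₂ _∷_ (trans (replicate-++-∷ k []) (cong (i ∷_) (++-identityʳ _)))
            (prependColumns-suc k (suc i) n [])
prependColumns-suc k i (suc n) (r ∷ rs) =
  cong₂ _∷_ (replicate-++-∷ k r) (prependColumns-suc k (suc i) n rs)

rowInsert-replicate : ∀ {i y} k r → i ≤ y →
  rowInsert y (replicate k i ++ r) ≡ (replicate k i ++ proj₁ (rowInsert y r) , proj₂ (rowInsert y r))
rowInsert-replicate         zero    r i≤y = refl
rowInsert-replicate {i} (suc k) r i≤y =
  trans (rowInsert-≮ (replicate k i ++ r) (≤⇒≯ i≤y))
        (cong (λ q → i ∷ proj₁ q , proj₂ q) (rowInsert-replicate k r i≤y))

insert-prependColumns : ∀ {y} k i n T → i ≤ y →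
  insert y (prependColumns k i n T) ≡ prependColumns k i n (insert y T)
insert-prependColumns     k i zero    T        i≤y = refl
insert-prependColumns {y} k i (suc n) []       i≤y
  rewrite subst (λ l → rowInsert y l ≡ (replicate k i ++ y ∷ [] , none))
                (++-identityʳ (replicate k i)) (rowInsert-replicate k [] i≤y) = refl
insert-prependColumns {y} k i (suc n) (r ∷ rs) i≤y
  rewrite rowInsert-replicate k r i≤y with rowInsert y r | rowInsert-bumped> y r
... | r′ , none  | _        = refl
... | r′ , out z | y<z ∷ [] =
  cong ((replicate k i ++ r′) ∷_) (insert-prependColumns k (suc i) n rs (≤-trans (s≤s i≤y) y<z))

prependColumns-⟵ : ∀ k i n T v → All (i ≤_) v →
  prependColumns k i n T ⟵ v ≡ prependColumns k i n (T ⟵ v)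
prependColumns-⟵ k i n T []      []          = refl
prependColumns-⟵ k i n T (x ∷ v) (i≤x ∷ i≤v) =
  trans (cong (_⟵ v) (insert-prependColumns k i n T i≤x)) (prependColumns-⟵ k i n (insert x T) v i≤v)

sortedInsert-≤ : ∀ {x y} ys → x ≤ y → sortedInsert x (y ∷ ys) ≡ x ∷ y ∷ ys
sortedInsert-≤ {x} {y} ys x≤y with x ≤ᵇ y | ≤ᵇ-reflects-≤ x y
... | true  | _        = refl
... | false | ofⁿ x≰y = ⊥-elim (x≰y x≤y)

sortedInsert-≰ : ∀ {x y} ys → ¬ x ≤ y → sortedInsert x (y ∷ ys) ≡ y ∷ sortedInsert x ys
sortedInsert-≰ {x} {y} ys x≰y with x ≤ᵇ y | ≤ᵇ-reflects-≤ x y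
... | true  | ofʸ x≤y = ⊥-elim (x≰y x≤y)
... | false | _       = refl

sortedInsert-front : ∀ {x} r → All (x ≤_) r → sortedInsert x r ≡ x ∷ r
sortedInsert-front []       _         = refl
sortedInsert-front (y ∷ ys) (x≤y ∷ _) = sortedInsert-≤ ys x≤y

sortedInsert-≥ : ∀ {x y ys} → y ≤ x → Sorted (y ∷ ys) →
                 sortedInsert x (y ∷ ys) ≡ y ∷ sortedInsert x ys
sortedInsert-≥ {x} {y} {ys} y≤x (y≤ys ∷ _) with x ≤? y
... | no x≰y  = sortedInsert-≰ ys x≰y
... | yes x≤y with ≤-antisym x≤y y≤x
...   | refl = trans (sortedInsert-≤ ys x≤y) (cong (x ∷_) (sym (sortedInsert-front ys y≤ys)))

rowInsert-≥ : ∀ x r → Sorted r → All (_≤ x) r → rowInsert x r ≡ (sortedInsert x r , none)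
rowInsert-≥ x []       _            _           = refl
rowInsert-≥ x (y ∷ ys) (y≤ys ∷ sys) (y≤x ∷ ys≤x)
  rewrite rowInsert-≮ ys (≤⇒≯ y≤x) | rowInsert-≥ x ys sys ys≤x
        | sortedInsert-≥ y≤x (y≤ys ∷ sys) = refl

rowInsert-sortedInsert-suc : ∀ x r → Sorted r →
  rowInsert x (sortedInsert (suc x) r) ≡ (sortedInsert x r , out (suc x))
rowInsert-sortedInsert-suc x []       _            = rowInsert-< [] (n<1+n x)
rowInsert-sortedInsert-suc x (y ∷ ys) (y≤ys ∷ sys) with x <? y
... | yes x<y rewrite sortedInsert-≤ ys x<y | rowInsert-< (y ∷ ys) (n<1+n x)
                    | sortedInsert-≤ ys (<⇒≤ x<y) = refl
... | no x≮y  rewrite sortedInsert-≰ ys x≮y | rowInsert-≮ (sortedInsert (suc x) ys) x≮y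
                    | rowInsert-sortedInsert-suc x ys sys
                    | sortedInsert-≥ (≮⇒≥ x≮y) (y≤ys ∷ sys) = refl

countdown : ℕ → ℕ → Word
countdown i zero    = []
countdown i (suc n) = i + n ∷ countdown i n

rowInsertWord-countdown-sortedInsert : ∀ i n r → Sorted r →
  rowInsertWord (sortedInsert (i + n) r) (countdown i n) ≡ (sortedInsert i r , countdown (suc i) n)
rowInsertWord-countdown-sortedInsert i zero    r sr rewrite +-identityʳ i = refl
rowInsertWord-countdown-sortedInsert i (suc n) r sr
  rewrite +-suc i n | rowInsert-sortedInsert-suc (i + n) r sr
        | rowInsertWord-countdown-sortedInsert i n r sr = refl

-- The top letter i + n is appended; each later letter j then bumps the j + 1 placed before it.
rowInsertWord-countdown : ∀ i n r → Sorted r → All (i ≤_) r → All (_≤ i + n) r →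
  rowInsertWord r (countdown i (suc n)) ≡ (i ∷ r , countdown (suc i) n)
rowInsertWord-countdown i n r sr i≤r r≤
  rewrite rowInsert-≥ (i + n) r sr r≤ | rowInsertWord-countdown-sortedInsert i n r sr
        | sortedInsert-front r i≤r = refl

⟵-countdown : ∀ i n T → Staircase i T → TopRowsAtMost (suc n) (i + n) T →
  T ⟵ countdown i (suc n) ≡ prependColumns 1 i (suc n) T

⟵-countdown-∷ : ∀ i n r rs → Sorted r → All (i ≤_) r → All (_≤ i + n) r →
  Staircase (suc i) rs → TopRowsAtMost n (i + n) rs →
  (r ∷ rs) ⟵ countdown i (suc n) ≡ (i ∷ r) ∷ prependColumns 1 (suc i) n rs
⟵-countdown-∷ i n r rs sr i≤r r≤ st rs≤ = begin
  (r ∷ rs) ⟵ countdown i (suc n)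
    ≡⟨ ⟵-∷ r rs (countdown i (suc n)) ⟩
  proj₁ (rowInsertWord r (countdown i (suc n))) ∷ rs ⟵ proj₂ (rowInsertWord r (countdown i (suc n)))
    ≡⟨ cong (λ q → proj₁ q ∷ rs ⟵ proj₂ q) (rowInsertWord-countdown i n r sr i≤r r≤) ⟩
  (i ∷ r) ∷ rs ⟵ countdown (suc i) n
    ≡⟨ cong ((i ∷ r) ∷_) (lowerRows n rs≤) ⟩
  (i ∷ r) ∷ prependColumns 1 (suc i) n rs ∎
  where
    open ≡-Reasoning
    lowerRows : ∀ n → TopRowsAtMost n (i + n) rs →
                rs ⟵ countdown (suc i) n ≡ prependColumns 1 (suc i) n rs
    lowerRows zero     _   = refl
    lowerRows (suc n′) rs≤ =
      ⟵-countdown (suc i) n′ rs st (subst (λ b → TopRowsAtMost (suc n′) b rs) (+-suc i n′) rs≤)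

-- Inserting a nonempty word into [] gives the same tableau as inserting it into [] ∷ [].
⟵-countdown i n []       _               _          =
  ⟵-countdown-∷ i n [] [] [] [] [] tt (topRowsAtMost-[] n (i + n))
⟵-countdown i n (r ∷ rs) (sr , i≤r , st) (r≤ ∷ rs≤) = ⟵-countdown-∷ i n r rs sr i≤r r≤ st rs≤

δ≡countdown : ∀ m → δ m ≡ countdown 1 m
δ≡countdown zero    = refl
δ≡countdown (suc m) = cong (suc m ∷_) (δ≡countdown m)

δ-positive : ∀ m → All (1 ≤_) (δ m)
δ-positive zero    = []
δ-positive (suc m) = s≤s z≤n ∷ δ-positive m

δ-atMost : ∀ m → All (_≤ m) (δ m)
δ-atMost zero    = []
δ-atMost (suc m) = ≤-refl ∷ All.map m≤n⇒m≤1+n (δ-atMost m)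

^ʷ-All : ∀ {Q : ℕ → Set} u k → All Q u → All Q (u ^ʷ k)
^ʷ-All u zero    _  = []
^ʷ-All u (suc k) qu = ++⁺ qu (^ʷ-All u k qu)

⟵-δ : ∀ m T → Staircase 1 T → TopRowsAtMost m m T → T ⟵ δ m ≡ prependColumns 1 1 m T
⟵-δ zero    T _  _  = refl
⟵-δ (suc m) T st bd rewrite δ≡countdown m = ⟵-countdown 1 m T st bd

⟵-δ^ : ∀ m k T → Staircase 1 T → TopRowsAtMost m m T →
  T ⟵ (δ m ^ʷ suc k) ≡ prependColumns (suc k) 1 m T
⟵-δ^ m zero    T st bd rewrite ++-identityʳ (δ m) = ⟵-δ m T st bd
⟵-δ^ m (suc k) T st bd = begin
  T ⟵ (δ m ++ δ m ^ʷ suc k)                           ≡⟨ ⟵-++ T (δ m) (δ m ^ʷ suc k) ⟩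
  (T ⟵ δ m) ⟵ (δ m ^ʷ suc k)                          ≡⟨ ⟵-δ^ m k (T ⟵ δ m) st′ bd′ ⟩
  prependColumns (suc k) 1 m (T ⟵ δ m)                ≡⟨ cong (prependColumns (suc k) 1 m) (⟵-δ m T st bd) ⟩
  prependColumns (suc k) 1 m (prependColumns 1 1 m T) ≡⟨ prependColumns-suc (suc k) 1 m T ⟩
  prependColumns (suc (suc k)) 1 m T                  ∎
  where
    open ≡-Reasoning
    st′ : Staircase 1 (T ⟵ δ m)
    st′ = ⟵-preserves (Staircase 1) insert-staircase (δ m) (δ-positive m) st
    bd′ : TopRowsAtMost m m (T ⟵ δ m)
    bd′ = ⟵-preserves (TopRowsAtMost m m) insert-topRowsAtMost (δ m) (δ-atMost m) bd

P-δ^-++ : ∀ m k w → IsWord w → P (δ m ^ʷ suc k ++ w) ≡ prependColumns (suc k) 1 m (P w)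
P-δ^-++ m k w pw = begin
  P (δ m ^ʷ suc k ++ w)             ≡⟨ ⟵-++ [] (δ m ^ʷ suc k) w ⟩
  P (δ m ^ʷ suc k) ⟵ w              ≡⟨ cong (_⟵ w) (⟵-δ^ m k [] tt (topRowsAtMost-[] m m)) ⟩
  prependColumns (suc k) 1 m [] ⟵ w ≡⟨ prependColumns-⟵ (suc k) 1 m [] w pw ⟩
  prependColumns (suc k) 1 m (P w)  ∎
  where open ≡-Reasoning

countAbove : ℕ → List ℕ → ℕ
countAbove m s = length (filter (m <?_) s)

countAbove-≤ : ∀ {m x} s → x ≤ m → countAbove m (x ∷ s) ≡ countAbove m s
countAbove-≤ {m} s x≤m = cong length (filter-reject (m <?_) {xs = s} (≤⇒≯ x≤m))

countAbove-> : ∀ {m y} s → m < y → countAbove m (y ∷ s) ≡ suc (countAbove m s)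
countAbove-> {m} s m<y = cong length (filter-accept (m <?_) {xs = s} m<y)

countAbove-++ : ∀ m p s → countAbove m s ≤ countAbove m (p ++ s)
countAbove-++ m p s rewrite filter-++ (m <?_) p s | length-++ (filter (m <?_) p) {filter (m <?_) s} =
  m≤n+m (countAbove m s) (countAbove m p)

countAbove-∷-mono-≤ : ∀ {m a b} y → countAbove m a ≤ countAbove m b →
                      countAbove m (y ∷ a) ≤ countAbove m (y ∷ b)
countAbove-∷-mono-≤ {m} y a≤b with m <ᵇ y
... | true  = s≤s a≤b
... | false = a≤b

countAbove-∷-mono-< : ∀ {m a b} y → countAbove m a < countAbove m b →
                      countAbove m (y ∷ a) < countAbove m (y ∷ b)
countAbove-∷-mono-< {m} y a<b with m <ᵇ y
... | true  = s≤s a<b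
... | false = a<b

rowInsert-countAbove-≤ : ∀ {m x} s → x ≤ m → countAbove m (proj₁ (rowInsert x s)) ≤ countAbove m s
rowInsert-countAbove-≤         []       x≤m = ≤-reflexive (countAbove-≤ [] x≤m)
rowInsert-countAbove-≤ {m} {x} (y ∷ ys) x≤m with x <? y
... | yes _ = ≤-trans (≤-reflexive (countAbove-≤ ys x≤m)) (countAbove-++ m (y ∷ []) ys)
... | no _  = countAbove-∷-mono-≤ y (rowInsert-countAbove-≤ ys x≤m)

rowInsertWord-countAbove-≤ : ∀ {m} s v → All (_≤ m) v →
  countAbove m (proj₁ (rowInsertWord s v)) ≤ countAbove m s
rowInsertWord-countAbove-≤ s []      _           = ≤-refl
rowInsertWord-countAbove-≤ s (x ∷ v) (x≤m ∷ v≤m) =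
  ≤-trans (rowInsertWord-countAbove-≤ (proj₁ (rowInsert x s)) v v≤m) (rowInsert-countAbove-≤ s x≤m)

rowInsert-above : ∀ {m x} s → x ≤ m → Any (m <_) s →
  countAbove m (proj₁ (rowInsert x s)) < countAbove m s ⊎
  (length (proj₁ (rowInsert x s)) ≡ length s × Any (m <_) (proj₁ (rowInsert x s)))
rowInsert-above {m} {x} (y ∷ ys) x≤m big with x <? y | big
... | yes _  | here m<y rewrite countAbove-≤ ys x≤m | countAbove-> ys m<y = inj₁ ≤-refl
... | yes _  | there a  = inj₂ (refl , there a)
... | no x≮y | here m<y = ⊥-elim (x≮y (≤-<-trans x≤m m<y))
... | no _   | there a with rowInsert-above ys x≤m a
...   | inj₁ fewer       = inj₁ (countAbove-∷-mono-< y fewer)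
...   | inj₂ (same , a′) = inj₂ (cong suc same , there a′)

rowInsertWord-above : ∀ {m} s v → All (_≤ m) v → Any (m <_) s →
  countAbove m (proj₁ (rowInsertWord s v)) < countAbove m s ⊎ length (proj₁ (rowInsertWord s v)) ≡ length s
rowInsertWord-above s []      _           _   = inj₂ refl
rowInsertWord-above s (x ∷ v) (x≤m ∷ v≤m) big with rowInsert-above s x≤m big
... | inj₁ fewer = inj₁ (≤-<-trans (rowInsertWord-countAbove-≤ (proj₁ (rowInsert x s)) v v≤m) fewer)
... | inj₂ (same , big′) with rowInsertWord-above (proj₁ (rowInsert x s)) v v≤m big′
...   | inj₁ fewer = inj₁ (<-≤-trans fewer (rowInsert-countAbove-≤ s x≤m))
...   | inj₂ same′ = inj₂ (trans same′ same)

rowInsertWord-prepends⇒atMost : ∀ {m} s v y p → All (_≤ m) v →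
  proj₁ (rowInsertWord s v) ≡ y ∷ p ++ s → All (_≤ m) s
rowInsertWord-prepends⇒atMost {m} s v y p v≤m eq with all? (_≤? m) s
... | yes s≤m = s≤m
... | no s≰m with rowInsertWord-above s v v≤m (Any.map ≰⇒> (¬All⇒Any¬ (_≤? m) s s≰m))
...   | inj₁ fewer =
  ⊥-elim (<⇒≱ fewer (subst (λ t → countAbove m s ≤ countAbove m t) (sym eq)
                            (countAbove-++ m (y ∷ p) s)))
...   | inj₂ same  =
  ⊥-elim (<⇒≢ (s≤s (length-++-≤ʳ s {p})) (sym (trans (cong length (sym eq)) same)))

⟵≡prependColumns⇒topRowsAtMost : ∀ {m} k i n T v → All (_≤ m) v →
  T ⟵ v ≡ prependColumns (suc k) i n T → TopRowsAtMost n m T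
⟵≡prependColumns⇒topRowsAtMost     k i zero    T        v _   _  = []
⟵≡prependColumns⇒topRowsAtMost     k i (suc n) []       v _   _  = []
⟵≡prependColumns⇒topRowsAtMost {m} k i (suc n) (s ∷ rs) v v≤m eq = s≤m ∷ lowerRows
  where
    rowEq×rowsEq : proj₁ (rowInsertWord s v) ≡ replicate (suc k) i ++ s
                 × rs ⟵ proj₂ (rowInsertWord s v) ≡ prependColumns (suc k) (suc i) n rs
    rowEq×rowsEq = ∷-injective (trans (sym (⟵-∷ s rs v)) eq)
    s≤m : All (_≤ m) s
    s≤m = rowInsertWord-prepends⇒atMost s v i (replicate k i) v≤m (proj₁ rowEq×rowsEq)
    lowerRows : TopRowsAtMost n m rs
    lowerRows = ⟵≡prependColumns⇒topRowsAtMost k (suc i) n rs (proj₂ (rowInsertWord s v))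
                  (proj₂ (rowInsertWord-All s v s≤m v≤m)) (proj₂ rowEq×rowsEq)

∈C-δ^⇔ : ∀ m k w → w ∈C (δ m ^ʷ suc k) ⇔ (IsWord w × TopRowsAtMost m m (P w))
∈C-δ^⇔ m k w = mk⇔ to from
  where
    open ≡-Reasoning
    to : w ∈C (δ m ^ʷ suc k) → IsWord w × TopRowsAtMost m m (P w)
    to (pw , commutes) = pw , ⟵≡prependColumns⇒topRowsAtMost k 1 m (P w) (δ m ^ʷ suc k)
      (^ʷ-All (δ m) (suc k) (δ-atMost m))
      (begin
        P w ⟵ (δ m ^ʷ suc k)             ≡⟨ sym (⟵-++ [] w (δ m ^ʷ suc k)) ⟩
        P (w ++ δ m ^ʷ suc k)            ≡⟨ sym commutes ⟩
        P (δ m ^ʷ suc k ++ w)            ≡⟨ P-δ^-++ m k w pw ⟩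
        prependColumns (suc k) 1 m (P w) ∎)
    from : IsWord w × TopRowsAtMost m m (P w) → w ∈C (δ m ^ʷ suc k)
    from (pw , bounded) = pw , (begin
      P (δ m ^ʷ suc k ++ w)            ≡⟨ P-δ^-++ m k w pw ⟩
      prependColumns (suc k) 1 m (P w) ≡⟨ sym (⟵-δ^ m k (P w) (P-staircase w pw) bounded) ⟩
      P w ⟵ (δ m ^ʷ suc k)             ≡⟨ sym (⟵-++ [] w (δ m ^ʷ suc k)) ⟩
      P (w ++ δ m ^ʷ suc k)            ∎)

proposition3p9 : (m : ℕ) → 1 ≤ m → (k : ℕ) → 1 ≤ k →
    (w : Word) → (w ∈C (δ m ^ʷ k)) ⇔ (w ∈C δ m)
proposition3p9 m _ zero    ()  w
proposition3p9 m _ (suc k) _   w = ⇔-sym ∈C-δ⇔ ⇔-∘ ∈C-δ^⇔ m k w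
  where
    ∈C-δ⇔ : w ∈C δ m ⇔ (IsWord w × TopRowsAtMost m m (P w))
    ∈C-δ⇔ = subst (λ u → w ∈C u ⇔ (IsWord w × TopRowsAtMost m m (P w)))
                  (++-identityʳ (δ m)) (∈C-δ^⇔ m 0 w)
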